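{- Let $p\geq 2$ and $q\geq 1$ be integers. A graph $G$ is $(p,q)$-biclique-Helly if and only if both of the following hold: (i) every $(p+1,q)$-biexpansion in $G$ has at least $q$ biuniversal vertices; (ii) if $p=2$, then there are no three bicliques $B_1,B_2,B_3$ of $G$, each of cardinality $q$, such that $B_1\cup B_2$, $B_2\cup B_3$ and $B_3\cup B_1$ are bicliques of $G$ but $B_1\cup B_2\cup B_3$ is not a biclique of $G$.
   Context: Graphs are finite, simple and undirected. A graph is complete bipartite if its vertex set can be partitioned into two (possibly empty) stable sets $X,Y$ with every vertex of $X$ adjacent to every vertex of $Y$ (edgeless graphs count as complete bipartite). A biclique of $G$ is a set of vertices inducing a complete bipartite graph; maximal means inclusion-wise maximal. The core of a family of sets is the intersection of its members. A family is $(p,q)$-intersecting if every nonempty subfamily of at most $p$ members has core of cardinality at least $q$, and has the $(p,q)$-Helly property if every nonempty $(p,q)$-intersecting subfamily has core of cardinality at least $q$. A graph is $(p,q)$-biclique-Helly if the family of its maximal bicliques has the $(p,q)$-Helly property. In a graph whose vertices each carry one of two labels, two different vertices are bicompatible if they are adjacent with different labels or nonadjacent with the same label; a vertex is biuniversal if it is bicompatible with every other vertex. Let $\mathcal D$ be a family of $p+1$ pairwise different bicliques of $G$, each of cardinality $q$, whose union $U$ is a biclique of $G$, and let $\{X,Y\}$ be the unique bipartition of $G[U]$ with $X,Y$ stable and $X$ complete to $Y$. The $(p+1,q)$-biexpansion of $\mathcal D$ in $G$ is the subgraph of $G$ induced by those vertices $v$ such that $P\cup\{v\}$ is a biclique for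 some union $P$ of $p$ pairwise different members of $\mathcal D$, where each such $v$ is labeled $X$ or $Y$ as follows: if $v\in X$ (resp. $v\in Y$) it is labeled $X$ (resp. $Y$), and if $v\notin U$ it is given the label that makes it bicompatible with every vertex of such a $P$ (this label does not depend on the choice of $P$). -}

module Defs where

open import Data.Bool using (Bool; true; false; if_then_else_)
open import Data.Nat using (ℕ; suc; _≤_)
open import Data.Fin using (Fin; _≟_)
open import Data.Fin.Subset using (Subset; _∈_; _∉_; _⊆_; _∩_; _∪_; ⋃; ⋂; ∣_∣; ⁅_⁆)
  renaming (⊥ to ∅)
open import Data.List using (List; []; length; tabulate)
open import Data.List.Relation.Unary.All using (All)
import Data.List.Membership.Propositional as LM
open import Data.Product using (Σ; Σ-syntax; ∃; _×_)
open import Data.Sum using (_⊎_)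
open import Data.Empty using (⊥)
open import Relation.Nullary using (¬_; does)
open import Relation.Binary.PropositionalEquality using (_≡_; _≢_)

record Graph : Set where
  field
    n      : ℕ
    Adj    : Fin n → Fin n → Bool
    sym    : ∀ u v → Adj u v ≡ Adj v u
    irrefl : ∀ v → Adj v v ≡ false
open Graph public

module _ (G : Graph) where
  private
    V = Fin (n G)
    A = Adj G

  Stable : Subset (n G) → Set
  Stable X = ∀ u v → u ∈ X → v ∈ X → A u v ≡ false

  Complete : Subset (n G) → Subset (n G) → Set
  Complete X Y = ∀ u v → u ∈ X → v ∈ Y → A u v ≡ true

  IsBipartition : Subset (n G) → Subset (n G) → Subset (n G) → Set
  IsBipartition S X Y =
    (X ∪ Y ≡ S) × (∀ v → v ∈ X → v ∈ Y → ⊥) × Stable X × Stable Y × Complete X Y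

  Biclique : Subset (n G) → Set
  Biclique S = Σ[ X ∈ Subset (n G) ] Σ[ Y ∈ Subset (n G) ] IsBipartition S X Y

  MaximalBiclique : Subset (n G) → Set
  MaximalBiclique S = Biclique S × (∀ T → Biclique T → S ⊆ T → T ≡ S)

core : ∀ {m} → List (Subset m) → Subset m
core = ⋂

Intersecting : (m : ℕ) → ℕ → ℕ → List (Subset m) → Set
Intersecting m p q F =
  ∀ (L : List (Subset m)) → L ≢ [] → length L ≤ p →
  (∀ S → S LM.∈ L → S LM.∈ F) → q ≤ ∣ core L ∣

HellyProperty : (m : ℕ) → ℕ → ℕ → (Subset m → Set) → Set
HellyProperty m p q Fam =
  ∀ (F : List (Subset m)) → F ≢ [] → All Fam F →
  Intersecting m p q F → q ≤ ∣ core F ∣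

BicliqueHelly : Graph → ℕ → ℕ → Set
BicliqueHelly G p q = HellyProperty (n G) p q (MaximalBiclique G)

module _ (G : Graph) where
  private
    V = Fin (n G)
    A = Adj G

  Union : ∀ {k} → (Fin k → Subset (n G)) → Subset (n G)
  Union D = ⋃ (tabulate D)

  UnionExcept : ∀ {k} → (Fin k → Subset (n G)) → Fin k → Subset (n G)
  UnionExcept D j = ⋃ (tabulate (λ i → if does (i ≟ j) then ∅ else D i))

  -- labels: true = X, false = Y
  Bicompatible : (V → Bool) → V → V → Set
  Bicompatible lab u v =
    (u ≢ v) × ((A u v ≡ true × lab u ≢ lab v) ⊎ (A u v ≡ false × lab u ≡ lab v))

  IsBiexpansionFamily : (p q : ℕ) → (Fin (suc p) → Subset (n G)) → Set
  IsBiexpansionFamily p q D =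
    (∀ i j → D i ≡ D j → i ≡ j) × (∀ i → Biclique G (D i)) ×
    (∀ i → ∣ D i ∣ ≡ q) × Biclique G (Union D)

  -- vertex set of the (p+1,q)-biexpansion of D: a union P of p pairwise
  -- different members of D is exactly the union of all members but one
  InBiexpansion : ∀ {p} → (Fin (suc p) → Subset (n G)) → V → Set
  InBiexpansion D v = Σ[ j ∈ Fin _ ] Biclique G (UnionExcept D j ∪ ⁅ v ⁆)

  -- lab is the labeling of the biexpansion of D w.r.t. the bipartition (X,Y)
  -- of G[Union D]  (only its values on the biexpansion matter)
  IsBiexpansionLabeling : ∀ {p} → (Fin (suc p) → Subset (n G)) →
    Subset (n G) → Subset (n G) → (V → Bool) → Set
  IsBiexpansionLabeling D X Y lab =
    (∀ v → v ∈ X → lab v ≡ true) × (∀ v → v ∈ Y → lab v ≡ false) ×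
    (∀ v → InBiexpansion D v → v ∉ Union D →
      ∀ j → Biclique G (UnionExcept D j ∪ ⁅ v ⁆) →
      ∀ w → w ∈ UnionExcept D j → Bicompatible lab v w)

  Biuniversal : ∀ {p} → (Fin (suc p) → Subset (n G)) → (V → Bool) → V → Set
  Biuniversal D lab v =
    InBiexpansion D v × (∀ w → InBiexpansion D w → w ≢ v → Bicompatible lab v w)

  CondI : ℕ → ℕ → Set
  CondI p q =
    ∀ (D : Fin (suc p) → Subset (n G)) → IsBiexpansionFamily p q D →
    ∀ X Y → IsBipartition G (Union D) X Y →
    ∀ lab → IsBiexpansionLabeling D X Y lab →
    Σ[ S ∈ Subset (n G) ] (q ≤ ∣ S ∣ × (∀ v → v ∈ S → Biuniversal D lab v))

  CondII : ℕ → ℕ → Set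
  CondII p q = p ≡ 2 → ¬ (Σ[ B₁ ∈ Subset (n G) ] Σ[ B₂ ∈ Subset (n G) ] Σ[ B₃ ∈ Subset (n G) ]
    (Biclique G B₁ × Biclique G B₂ × Biclique G B₃ ×
     ∣ B₁ ∣ ≡ q × ∣ B₂ ∣ ≡ q × ∣ B₃ ∣ ≡ q ×
     Biclique G (B₁ ∪ B₂) × Biclique G (B₂ ∪ B₃) × Biclique G (B₃ ∪ B₁) ×
     ¬ Biclique G (B₁ ∪ B₂ ∪ B₃)))

{-# OPTIONS --safe #-}
-- A vertex set is a biclique exactly when it has a side labelling l, i.e. Adj u v ≡ l u xor l v
-- on it.  Hence inside a biclique adjacency is determined by adjacency to any one apex x, and
-- conversely S is a biclique as soon as some vertex x, in S or not, forms a biclique with any two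
-- vertices of S: label S by adjacency to x.
-- Forward: for each vertex w pick a maximal biclique containing all members of the family but one
-- and, when w lies in the biexpansion, w itself.  These form a (p,q)-intersecting family, so its
-- core has q vertices, and each of them is bicompatible with every vertex of the biexpansion.
-- For (ii), maximal bicliques over the three pairwise unions share a vertex, an apex for B₁ ∪ B₂ ∪ B₃.
-- Backward: by induction on the size of a (p,q)-intersecting family of maximal bicliques, the
-- cores of the subfamilies omitting one of p + 1 chosen members contain q-sets S i.  If two of
-- them coincide their common value lies in the core.  Otherwise they form a biexpansion family
-- (the union is a biclique by (ii) if p = 2 and by the apex argument if p ≥ 3), and the q
-- biuniversal vertices given by (i) lie in every member.
module Submission where

open import Defs hiding (sym)
open import Data.Bool using (Bool; true; false; not; _xor_; if_then_else_)
open import Data.Bool.Properties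
  using (xor-assoc; xor-comm; xor-same; xor-identityʳ; not-involutive; not-injective)
  renaming (_≟_ to _≟ᵇ_)
open import Data.Empty using (⊥; ⊥-elim)
open import Data.Fin using (Fin; zero; suc; _≟_; inject≤; punchIn; punchOut)
open import Data.Fin.Patterns using (0F; 1F; 2F)
open import Data.Fin.Properties
  using (all?; any?; ¬∀⟶∃¬; pigeonhole; <⇒≢; inject≤-injective; punchIn-punchOut)
open import Data.Fin.Subset using (Subset; _∈_; _∉_; _⊆_; _∩_; _∪_; ⋃; ⋂; ∣_∣; ⁅_⁆; Nonempty)
  renaming (⊥ to ∅)
open import Data.Fin.Subset.Properties
  using ( _∈?_; x∈p∪q⁺; x∈p∪q⁻; x∈p∩q⁺; x∈p∩q⁻; p⊆p∪q; q⊆p∪q; ∈⊤; ∉⊥; x∈⁅x⁆; x∈⁅y⁆⇒x≡y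
        ; ⊆-refl; ⊆-trans; ⊆-antisym; ⊆-min; nonempty?; Empty-unique; ∣⊥∣≡0; in⊆in; out⊆
        ; p⊆q⇒∣p∣≤∣q∣)
open import Data.List using (List; []; _∷_; length; tabulate; lookup; allFin)
open import Data.List.Properties using (length-tabulate; tabulate-lookup)
open import Data.List.Membership.Propositional using () renaming (_∈_ to _∈ₗ_)
open import Data.List.Membership.Propositional.Properties
  using (∈-tabulate⁺; ∈-tabulate⁻; ∈-allFin; ∈-lookup)
import Data.List.Membership.DecPropositional as DecMembership
open import Data.List.Relation.Unary.All using (All; []; _∷_)
import Data.List.Relation.Unary.All as All
open import Data.List.Relation.Unary.All.Properties using (tabulate⁺; ¬Any⇒All¬)
open import Data.List.Relation.Unary.Any using (here; there; index)
open import Data.List.Relation.Unary.Any.Properties using (lookup-index)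
open import Data.Nat using (ℕ; zero; suc; _+_; _≤_; z≤n; s≤s; _≤?_)
open import Data.Nat.Properties using (≤-trans; ≤-reflexive; <⇒≤; ≰⇒>; +-suc; +-identityʳ)
open import Data.Product using (∃; _×_; _,_; proj₁; proj₂)
open import Data.Sum using (_⊎_; inj₁; inj₂)
import Data.Vec as Vec
open import Data.Vec using (_∷_)
open import Data.Vec.Properties using (lookup∘tabulate; lookup⇒[]=; []=⇒lookup; ≡-dec)
open import Function using (_∘_)
open import Relation.Nullary using (Dec; yes; no; does; ¬?; contradiction)
open import Relation.Nullary.Decidable
  using (dec-true; dec-false; map′; _→-dec_; _×-dec_; decidable-stable)
open import Relation.Binary.PropositionalEquality
  using (_≡_; _≢_; refl; sym; trans; cong; cong₂; subst; ≢-sym; module ≡-Reasoning)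

open ≡-Reasoning

xor-cancel-common : ∀ x a b → (x xor a) xor (x xor b) ≡ a xor b
xor-cancel-common false a     b = refl
xor-cancel-common true  true  b = refl
xor-cancel-common true  false b = not-involutive b

xor-cancelʳ : ∀ a b → (a xor b) xor b ≡ a
xor-cancelʳ a b = trans (xor-assoc a b b) (trans (cong (a xor_) (xor-same b)) (xor-identityʳ a))

xor-≢ : ∀ {a b} → a ≢ b → a xor b ≡ true
xor-≢ {true}  {true}  a≢b = contradiction refl a≢b
xor-≢ {true}  {false} _   = refl
xor-≢ {false} {true}  _   = refl
xor-≢ {false} {false} a≢b = contradiction refl a≢b

xor-cases : ∀ a b → (a xor b ≡ true × a ≢ b) ⊎ (a xor b ≡ false × a ≡ b)
xor-cases true  true  = inj₂ (refl , refl)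
xor-cases true  false = inj₁ (refl , λ ())
xor-cases false true  = inj₁ (refl , λ ())
xor-cases false false = inj₂ (refl , refl)

module _ {m : ℕ} where

  truths : (Fin m → Bool) → Subset m
  truths = Vec.tabulate

  ∈-truths⁺ : ∀ {f x} → f x ≡ true → x ∈ truths f
  ∈-truths⁺ {f} {x} fx = lookup⇒[]= x (truths f) (trans (lookup∘tabulate f x) fx)

  ∈-truths⁻ : ∀ {f x} → x ∈ truths f → f x ≡ true
  ∈-truths⁻ {f} {x} x∈ = trans (sym (lookup∘tabulate f x)) ([]=⇒lookup x∈)

  ∪-least : ∀ {S T M : Subset m} → S ⊆ M → T ⊆ M → S ∪ T ⊆ M
  ∪-least {S} {T} S⊆M T⊆M x∈ with x∈p∪q⁻ S T x∈
  ... | inj₁ x∈S = S⊆M x∈S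
  ... | inj₂ x∈T = T⊆M x∈T

  ∈-∪⁅⁆ : ∀ {S : Subset m} v → v ∈ S ∪ ⁅ v ⁆
  ∈-∪⁅⁆ v = x∈p∪q⁺ (inj₂ (x∈⁅x⁆ v))

  ∈-∪⁅⁆⁻ : ∀ {S : Subset m} {v x} → x ∈ S ∪ ⁅ v ⁆ → x ∈ S ⊎ x ≡ v
  ∈-∪⁅⁆⁻ {S} {v} x∈ with x∈p∪q⁻ S ⁅ v ⁆ x∈
  ... | inj₁ x∈S = inj₁ x∈S
  ... | inj₂ x∈v = inj₂ (x∈⁅y⁆⇒x≡y v x∈v)

  ∪⁅⁆-⊆ : ∀ {S T : Subset m} {v} → S ⊆ T → v ∈ T → S ∪ ⁅ v ⁆ ⊆ T
  ∪⁅⁆-⊆ {T = T} {v} S⊆T v∈T =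
    ∪-least S⊆T (λ x∈ → subst (_∈ T) (sym (x∈⁅y⁆⇒x≡y v x∈)) v∈T)

  ∈-⋂⁺ : ∀ {x} (L : List (Subset m)) → (∀ M → M ∈ₗ L → x ∈ M) → x ∈ ⋂ L
  ∈-⋂⁺ []      _    = ∈⊤
  ∈-⋂⁺ (M ∷ L) x∈ML = x∈p∩q⁺ (x∈ML M (here refl) , ∈-⋂⁺ L (λ M′ → x∈ML M′ ∘ there))

  ∈-⋂⁻ : ∀ {x M} {L : List (Subset m)} → x ∈ ⋂ L → M ∈ₗ L → x ∈ M
  ∈-⋂⁻ {L = M ∷ L} x∈ (here refl) = proj₁ (x∈p∩q⁻ M (⋂ L) x∈)
  ∈-⋂⁻ {L = M ∷ L} x∈ (there M∈)  = ∈-⋂⁻ (proj₂ (x∈p∩q⁻ M (⋂ L) x∈)) M∈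

  ∈-⋂-tabulate⁺ : ∀ {k x} (f : Fin k → Subset m) → (∀ a → x ∈ f a) → x ∈ ⋂ (tabulate f)
  ∈-⋂-tabulate⁺ {x = x} f x∈f = ∈-⋂⁺ (tabulate f) λ M M∈ → member (∈-tabulate⁻ M∈)
    where
      member : ∀ {M} → ∃ (λ a → M ≡ f a) → x ∈ M
      member (a , refl) = x∈f a

  ∈-⋂-tabulate⁻ : ∀ {k x} {f : Fin k → Subset m} → x ∈ ⋂ (tabulate f) → ∀ a → x ∈ f a
  ∈-⋂-tabulate⁻ x∈ a = ∈-⋂⁻ x∈ (∈-tabulate⁺ a)

  ∈-⋃-tabulate⁺ : ∀ {k} (D : Fin k → Subset m) i → D i ⊆ ⋃ (tabulate D)
  ∈-⋃-tabulate⁺ D zero    x∈ = x∈p∪q⁺ (inj₁ x∈)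
  ∈-⋃-tabulate⁺ D (suc i) x∈ = x∈p∪q⁺ (inj₂ (∈-⋃-tabulate⁺ (D ∘ suc) i x∈))

  ∈-⋃-tabulate⁻ : ∀ {k x} (D : Fin k → Subset m) →
    x ∈ ⋃ (tabulate D) → ∃ λ i → x ∈ D i
  ∈-⋃-tabulate⁻ {zero}  D x∈ = ⊥-elim (∉⊥ x∈)
  ∈-⋃-tabulate⁻ {suc k} D x∈ with x∈p∪q⁻ (D zero) _ x∈
  ... | inj₁ x∈D₀ = zero , x∈D₀
  ... | inj₂ x∈⋃ with ∈-⋃-tabulate⁻ (D ∘ suc) x∈⋃
  ...   | i , x∈Dᵢ = suc i , x∈Dᵢ

  nonempty-of-size : ∀ {q} {S : Subset m} → 1 ≤ q → q ≤ ∣ S ∣ → Nonempty S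
  nonempty-of-size {S = S} 1≤q q≤∣S∣ with nonempty? S
  ... | yes S≠∅ = S≠∅
  ... | no  S=∅
    with () ← subst (1 ≤_) (∣⊥∣≡0 m) (subst (λ T → 1 ≤ ∣ T ∣) (Empty-unique S=∅) (≤-trans 1≤q q≤∣S∣))

⊆-of-size : ∀ {m} q (S : Subset m) → q ≤ ∣ S ∣ → ∃ λ T → T ⊆ S × ∣ T ∣ ≡ q
⊆-of-size {m} zero S _ = ∅ , ⊆-min S , ∣⊥∣≡0 m
⊆-of-size (suc q) (true ∷ S) (s≤s q≤∣S∣) with ⊆-of-size q S q≤∣S∣
... | T , T⊆S , ∣T∣≡q = true ∷ T , in⊆in T⊆S , cong suc ∣T∣≡q
⊆-of-size (suc q) (false ∷ S) q<∣S∣ with ⊆-of-size (suc q) S q<∣S∣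
... | T , T⊆S , ∣T∣≡q = false ∷ T , out⊆ T⊆S , ∣T∣≡q

fresh : ∀ {p} (js : List (Fin (suc p))) → length js ≤ p → ∃ λ l → All (_≢ l) js
fresh {p} js ∣js∣≤p with all? (λ l → DecMembership._∈?_ _≟_ l js)
... | no uncovered with ¬∀⟶∃¬ (suc p) _ (λ l → DecMembership._∈?_ _≟_ l js) uncovered
...   | l , l∉js = l , All.map (_∘ sym) (¬Any⇒All¬ js l∉js)
fresh {p} js ∣js∣≤p | yes covered
  with i , j , i<j , same ← pigeonhole (s≤s ∣js∣≤p) (λ l → index (covered l)) =
  contradiction
    (trans (lookup-index (covered i)) (trans (cong (lookup js) same) (sym (lookup-index (covered j)))))
    (<⇒≢ i<j)

ContainsAllBut : ∀ {m k} → (Fin k → Subset m) → Fin k → Subset m → Set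
ContainsAllBut D j M = ∀ i → i ≢ j → D i ⊆ M

module _ {m p : ℕ} (D : Fin (suc p) → Subset m) where

  common-member : (L : List (Subset m)) (js : List (Fin (suc p))) → length js + length L ≤ p →
    (∀ M → M ∈ₗ L → ∃ λ j → ContainsAllBut D j M) →
    ∃ λ l → All (_≢ l) js × (∀ M → M ∈ₗ L → D l ⊆ M)
  common-member [] js ∣js∣≤p _ with fresh js (subst (_≤ p) (+-identityʳ (length js)) ∣js∣≤p)
  ... | l , js≢l = l , js≢l , λ _ ()
  common-member (M ∷ L) js len≤p covers with covers M (here refl)
  ... | j , M⊇ with common-member L (j ∷ js) (subst (_≤ p) (+-suc (length js) (length L)) len≤p)
                                       (λ M′ → covers M′ ∘ there)
  ...   | l , j≢l ∷ js≢l , L⊇ =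
    l , js≢l , λ { _ (here refl) → M⊇ l (≢-sym j≢l) ; M′ (there M′∈) → L⊇ M′ M′∈ }

  intersecting-of-containsAllBut : ∀ {q} → (∀ i → q ≤ ∣ D i ∣) → {F : List (Subset m)} →
    All (λ M → ∃ λ j → ContainsAllBut D j M) F → Intersecting m p q F
  intersecting-of-containsAllBut q≤∣D∣ covers L _ ∣L∣≤p L⊆F
    with l , _ , L⊇ ← common-member L [] ∣L∣≤p (λ M M∈ → All.lookup covers (L⊆F M M∈)) =
    ≤-trans (q≤∣D∣ l) (p⊆q⇒∣p∣≤∣q∣ λ x∈ → ∈-⋂⁺ L λ M M∈ → L⊇ M M∈ x∈)

core-⊇-duplicate : ∀ {m k r} {f : Fin k → Subset m} {S : Fin r → Subset m} {i i′} →
  (∀ a → ∃ λ j → ContainsAllBut S j (f a)) → i ≢ i′ → S i ≡ S i′ → S i ⊆ ⋂ (tabulate f)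
core-⊇-duplicate {f = f} {S} {i} {i′} covers i≢i′ Si≡Si′ {x} x∈ = ∈-⋂-tabulate⁺ f contained
  where
    contained : ∀ a → x ∈ f a
    contained a with covers a
    ... | j , c with i ≟ j
    ...   | no  i≢j  = c i i≢j x∈
    ...   | yes refl = c i′ (≢-sym i≢i′) (subst (x ∈_) Si≡Si′ x∈)

intersecting-mono : ∀ {m p q} {F F′ : List (Subset m)} →
  (∀ M → M ∈ₗ F′ → M ∈ₗ F) → Intersecting m p q F → Intersecting m p q F′
intersecting-mono F′⊆F intersecting L L≢[] ∣L∣≤p L⊆F′ =
  intersecting L L≢[] ∣L∣≤p (λ M → F′⊆F M ∘ L⊆F′ M)

∈-tabulate-∘ : ∀ {A : Set} {k r} {f : Fin k → A} {g : Fin r → Fin k} {M} →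
  M ∈ₗ tabulate (f ∘ g) → M ∈ₗ tabulate f
∈-tabulate-∘ {f = f} {g} M∈ with ∈-tabulate⁻ M∈
... | a , refl = ∈-tabulate⁺ (g a)

module _ (G : Graph) where
  private
    V = Fin (n G)
    Sub = Subset (n G)

  -- The paper's bicompatibility (Defs.Bicompatible) without the requirement u ≢ v.
  Compatible : (V → Bool) → V → V → Set
  Compatible l u v = Adj G u v ≡ l u xor l v

  SideLabelling : Sub → (V → Bool) → Set
  SideLabelling S l = ∀ u v → u ∈ S → v ∈ S → Compatible l u v

  compatible-sym : ∀ {l u v} → Compatible l u v → Compatible l v u
  compatible-sym {l} {u} {v} e = trans (Graph.sym G v u) (trans e (xor-comm (l u) (l v)))

  compatible-refl : ∀ {l v} → Compatible l v v
  compatible-refl {l} {v} = trans (irrefl G v) (sym (xor-same (l v)))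

  compatible⇒bicompatible : ∀ {l u v} → u ≢ v → Compatible l u v → Bicompatible G l u v
  compatible⇒bicompatible {l} {u} {v} u≢v e =
    u≢v , subst (λ x → (x ≡ true × l u ≢ l v) ⊎ (x ≡ false × l u ≡ l v)) (sym e)
                (xor-cases (l u) (l v))

  bicompatible⇒compatible : ∀ {l u v} → Bicompatible G l u v → Compatible l u v
  bicompatible⇒compatible (_ , inj₁ (adjacent , lu≢lv)) = trans adjacent (sym (xor-≢ lu≢lv))
  bicompatible⇒compatible {l} {u} (_ , inj₂ (nonadjacent , lu≡lv)) =
    trans nonadjacent (sym (trans (cong (l u xor_) (sym lu≡lv)) (xor-same (l u))))

  bipartition-side : ∀ {S X Y v} → IsBipartition G S X Y → v ∈ S → v ∈ X ⊎ v ∈ Y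
  bipartition-side {X = X} {Y} (X∪Y≡S , _) v∈S = x∈p∪q⁻ X Y (subst (_ ∈_) (sym X∪Y≡S) v∈S)

  bipartition-sideLabelling : ∀ {S X Y l} → IsBipartition G S X Y →
    (∀ v → v ∈ X → l v ≡ true) → (∀ v → v ∈ Y → l v ≡ false) → SideLabelling S l
  bipartition-sideLabelling {l = l} bp@(_ , _ , X-stable , Y-stable , X~Y) onX onY u v u∈S v∈S
    with bipartition-side bp u∈S | bipartition-side bp v∈S
  ... | inj₁ u∈X | inj₁ v∈X rewrite onX u u∈X | onX v v∈X = X-stable u v u∈X v∈X
  ... | inj₁ u∈X | inj₂ v∈Y rewrite onX u u∈X | onY v v∈Y = X~Y u v u∈X v∈Y
  ... | inj₂ u∈Y | inj₁ v∈X rewrite onY u u∈Y | onX v v∈X = trans (Graph.sym G u v) (X~Y v u v∈X u∈Y)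
  ... | inj₂ u∈Y | inj₂ v∈Y rewrite onY u u∈Y | onY v v∈Y = Y-stable u v u∈Y v∈Y

  indicator-sideLabelling : ∀ {S X Y} → IsBipartition G S X Y →
    SideLabelling S (λ v → does (v ∈? X))
  indicator-sideLabelling {X = X} bp@(_ , disjoint , _) =
    bipartition-sideLabelling bp (λ v → dec-true (v ∈? X))
      (λ v v∈Y → dec-false (v ∈? X) λ v∈X → disjoint v v∈X v∈Y)

  biclique⇒sideLabelling : ∀ {S} → Biclique G S → ∃ (SideLabelling S)
  biclique⇒sideLabelling (X , _ , bp) = (λ v → does (v ∈? X)) , indicator-sideLabelling bp

  sideLabelling⇒biclique : ∀ {S l} → SideLabelling S l → Biclique G S
  sideLabelling⇒biclique {S} {l} L =
    X , Y , ⊆-antisym (∪-least (proj₁ ∘ inX) (proj₁ ∘ inY)) split ,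
    disjoint , X-stable , Y-stable , X~Y
    where
      X = S ∩ truths l
      Y = S ∩ truths (not ∘ l)
      inX : ∀ {v} → v ∈ X → v ∈ S × l v ≡ true
      inX {v} v∈X = let v∈S , v∈l = x∈p∩q⁻ S _ v∈X in v∈S , ∈-truths⁻ v∈l
      inY : ∀ {v} → v ∈ Y → v ∈ S × l v ≡ false
      inY {v} v∈Y = let v∈S , v∈l = x∈p∩q⁻ S _ v∈Y in v∈S , not-injective (∈-truths⁻ v∈l)
      split : S ⊆ X ∪ Y
      split {v} v∈S with l v in lv
      ... | true  = x∈p∪q⁺ (inj₁ (x∈p∩q⁺ (v∈S , ∈-truths⁺ lv)))
      ... | false = x∈p∪q⁺ (inj₂ (x∈p∩q⁺ (v∈S , ∈-truths⁺ (cong not lv))))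
      disjoint : ∀ v → v ∈ X → v ∈ Y → ⊥
      disjoint v v∈X v∈Y with () ← trans (sym (proj₂ (inX v∈X))) (proj₂ (inY v∈Y))
      by-labels : ∀ {u v a b} → u ∈ S × l u ≡ a → v ∈ S × l v ≡ b → Adj G u v ≡ a xor b
      by-labels (u∈S , lu) (v∈S , lv) = trans (L _ _ u∈S v∈S) (cong₂ _xor_ lu lv)
      X-stable : Stable G X
      X-stable u v u∈X v∈X = by-labels (inX u∈X) (inX v∈X)
      Y-stable : Stable G Y
      Y-stable u v u∈Y v∈Y = by-labels (inY u∈Y) (inY v∈Y)
      X~Y : Complete G X Y
      X~Y u v u∈X v∈Y = by-labels (inX u∈X) (inY v∈Y)

  apex : ∀ {S l x a b} → SideLabelling S l → x ∈ S → a ∈ S → b ∈ S →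
    Adj G a b ≡ Adj G x a xor Adj G x b
  apex {l = l} {x} {a} {b} L x∈ a∈ b∈ = begin
    Adj G a b                         ≡⟨ L a b a∈ b∈ ⟩
    l a xor l b                       ≡⟨ xor-cancel-common (l x) (l a) (l b) ⟨
    (l x xor l a) xor (l x xor l b)   ≡⟨ cong₂ _xor_ (L x a x∈ a∈) (L x b x∈ b∈) ⟨
    Adj G x a xor Adj G x b           ∎

  biclique-apex : ∀ {M x a b} → Biclique G M → x ∈ M → a ∈ M → b ∈ M →
    Adj G a b ≡ Adj G x a xor Adj G x b
  biclique-apex B with l , L ← biclique⇒sideLabelling B = apex {l = l} L

  biclique-⊆ : ∀ {S T} → S ⊆ T → Biclique G T → Biclique G S
  biclique-⊆ S⊆T B with l , L ← biclique⇒sideLabelling B =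
    sideLabelling⇒biclique {l = l} λ u v u∈ v∈ → L u v (S⊆T u∈) (S⊆T v∈)

  biclique-via-apex : ∀ {S} x →
    (∀ a b → a ∈ S → b ∈ S → ∃ λ M → Biclique G M × x ∈ M × a ∈ M × b ∈ M) → Biclique G S
  biclique-via-apex x meet = sideLabelling⇒biclique {l = Adj G x} λ a b a∈ b∈ →
    let _ , B , x∈M , a∈M , b∈M = meet a b a∈ b∈ in biclique-apex B x∈M a∈M b∈M

  sideLabelling? : ∀ S l → Dec (SideLabelling S l)
  sideLabelling? S l = all? λ u → all? λ v →
    (u ∈? S) →-dec ((v ∈? S) →-dec (Adj G u v ≟ᵇ l u xor l v))

  biclique? : ∀ S → Dec (Biclique G S)
  biclique? S with nonempty? S
  ... | no  S=∅ =
    yes (sideLabelling⇒biclique {l = λ _ → false} λ u _ u∈S _ → contradiction (u , u∈S) S=∅)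
  ... | yes (x , x∈S) =
    map′ (sideLabelling⇒biclique {l = Adj G x}) (λ B a b a∈ b∈ → biclique-apex B x∈S a∈ b∈)
      (sideLabelling? S (Adj G x))

  compatible-through : ∀ {M l c a b} → Biclique G M → c ∈ M → a ∈ M → b ∈ M →
    Compatible l c a → Compatible l c b → Compatible l a b
  compatible-through {l = l} {c} {a} {b} B c∈ a∈ b∈ c~a c~b = begin
    Adj G a b                         ≡⟨ biclique-apex B c∈ a∈ b∈ ⟩
    Adj G c a xor Adj G c b           ≡⟨ cong₂ _xor_ c~a c~b ⟩
    (l c xor l a) xor (l c xor l b)   ≡⟨ xor-cancel-common (l c) (l a) (l b) ⟩
    l a xor l b                       ∎

  sideLabelling-insert : ∀ {M l v} → SideLabelling M l → (∀ b → b ∈ M → Compatible l v b) →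
    SideLabelling (M ∪ ⁅ v ⁆) l
  sideLabelling-insert {l = l} L v~ a b a∈ b∈ with ∈-∪⁅⁆⁻ a∈ | ∈-∪⁅⁆⁻ b∈
  ... | inj₁ a∈M | inj₁ b∈M = L a b a∈M b∈M
  ... | inj₁ a∈M | inj₂ refl = compatible-sym {l} (v~ a a∈M)
  ... | inj₂ refl | inj₁ b∈M = v~ b b∈M
  ... | inj₂ refl | inj₂ refl = compatible-refl {l}

  grow : ∀ {S} → Biclique G S → (C : List V) →
    ∃ λ R → S ⊆ R × Biclique G R × (∀ v → v ∈ₗ C → Biclique G (R ∪ ⁅ v ⁆) → v ∈ R)
  grow B [] = _ , ⊆-refl , B , λ _ ()
  grow {S} B (v ∷ C) with biclique? (S ∪ ⁅ v ⁆)
  ... | yes B′ with R , S∪v⊆R , BR , closed ← grow B′ C =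
    R , ⊆-trans (p⊆p∪q _) S∪v⊆R , BR ,
    λ { _ (here refl) _ → S∪v⊆R (∈-∪⁅⁆ v) ; u (there u∈C) → closed u u∈C }
  ... | no ¬B′ with R , S⊆R , BR , closed ← grow B C =
    R , S⊆R , BR ,
    λ { _ (here refl) BR∪v →
          contradiction (biclique-⊆ (∪⁅⁆-⊆ (⊆-trans S⊆R (p⊆p∪q _)) (∈-∪⁅⁆ v)) BR∪v) ¬B′
      ; u (there u∈C) → closed u u∈C }

  extend-maximal : ∀ {S} → Biclique G S → ∃ λ M → S ⊆ M × MaximalBiclique G M
  extend-maximal B with R , S⊆R , BR , closed ← grow B (allFin (n G)) =
    R , S⊆R , BR , λ T BT R⊆T →
      ⊆-antisym (λ {t} t∈T → closed t (∈-allFin t) (biclique-⊆ (∪⁅⁆-⊆ R⊆T t∈T) BT)) R⊆T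

  maximal-absorbs : ∀ {M v} → MaximalBiclique G M → Biclique G (M ∪ ⁅ v ⁆) → v ∈ M
  maximal-absorbs {M} {v} (_ , maximal) B = subst (v ∈_) (maximal _ B (p⊆p∪q _)) (∈-∪⁅⁆ v)

  maximal-containing : ∀ {k} {D : Fin k → Sub} {j S} → Biclique G S → ContainsAllBut D j S →
    ∃ λ M → MaximalBiclique G M × ContainsAllBut D j M
  maximal-containing B S⊇ with M , S⊆M , maxM ← extend-maximal B =
    M , maxM , λ i i≢j → ⊆-trans (S⊇ i i≢j) S⊆M

  module _ {p} (D : Fin (suc p) → Sub) where

    ∈-Union⁺ : ∀ i → D i ⊆ Union G D
    ∈-Union⁺ = ∈-⋃-tabulate⁺ D

    ∈-Union⁻ : ∀ {x} → x ∈ Union G D → ∃ λ i → x ∈ D i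
    ∈-Union⁻ = ∈-⋃-tabulate⁻ D

    ∈-UnionExcept⁺ : ∀ {i j} → i ≢ j → D i ⊆ UnionExcept G D j
    ∈-UnionExcept⁺ {i} {j} i≢j x∈ = ∈-⋃-tabulate⁺ (λ i → if does (i ≟ j) then ∅ else D i) i
      (subst (λ b → _ ∈ (if b then ∅ else D i)) (sym (dec-false (i ≟ j) i≢j)) x∈)

    ∈-UnionExcept⁻ : ∀ {j x} → x ∈ UnionExcept G D j → ∃ λ i → i ≢ j × x ∈ D i
    ∈-UnionExcept⁻ {j} x∈ with ∈-⋃-tabulate⁻ (λ i → if does (i ≟ j) then ∅ else D i) x∈
    ... | i , x∈Dᵢ with i ≟ j
    ...   | yes _   = ⊥-elim (∉⊥ x∈Dᵢ)
    ...   | no  i≢j = i , i≢j , x∈Dᵢ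

    UnionExcept⊆Union : ∀ {j} → UnionExcept G D j ⊆ Union G D
    UnionExcept⊆Union {j} x∈ with i , _ , x∈Dᵢ ← ∈-UnionExcept⁻ {j} x∈ = ∈-Union⁺ i x∈Dᵢ

    UnionExcept-least : ∀ {j M} → ContainsAllBut D j M → UnionExcept G D j ⊆ M
    UnionExcept-least {j} M⊇ x∈ with i , i≢j , x∈Dᵢ ← ∈-UnionExcept⁻ {j} x∈ = M⊇ i i≢j x∈Dᵢ

    containsAllBut-inBiexpansion : ∀ {j M v} → Biclique G M → ContainsAllBut D j M → v ∈ M →
      InBiexpansion G D v
    containsAllBut-inBiexpansion {j} B M⊇ v∈M =
      j , biclique-⊆ (∪⁅⁆-⊆ (UnionExcept-least M⊇) v∈M) B

  module _ {p q} (D : Fin (suc p) → Sub) (1≤q : 1 ≤ q) (∣D∣≡q : ∀ i → ∣ D i ∣ ≡ q) where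

    member-nonempty : ∀ i → Nonempty (D i)
    member-nonempty i = nonempty-of-size 1≤q (≤-reflexive (sym (∣D∣≡q i)))

    part-nonempty : 1 ≤ p → ∀ j → Nonempty (UnionExcept G D j)
    part-nonempty 1≤p j with l , j≢l ∷ [] ← fresh (j ∷ []) 1≤p =
      let x , x∈Dₗ = member-nonempty l in x , ∈-UnionExcept⁺ D (≢-sym j≢l) x∈Dₗ

  module _ {p} (D : Fin (suc p) → Sub) {X Y} (bp : IsBipartition G (Union G D) X Y)
           {lab} (labelling : IsBiexpansionLabeling G D X Y lab) where

    compatible-with-part : ∀ {j w x} → w ∈ UnionExcept G D j →
      Biclique G (UnionExcept G D j ∪ ⁅ x ⁆) → Compatible lab w x
    compatible-with-part {j} {w} {x} w∈P B with x ∈? Union G D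
    ... | yes x∈U = bipartition-sideLabelling bp (proj₁ labelling) (proj₁ (proj₂ labelling))
                      w x (UnionExcept⊆Union D {j} w∈P) x∈U
    ... | no  x∉U = compatible-sym {lab}
                      (bicompatible⇒compatible (proj₂ (proj₂ labelling) x (j , B) x∉U j B w w∈P))

    containsAllBut-sideLabelling : ∀ {j M} → Biclique G M → ContainsAllBut D j M →
      Nonempty (UnionExcept G D j) → SideLabelling M lab
    containsAllBut-sideLabelling {j} B M⊇ (w , w∈P) a b a∈ b∈ =
      compatible-through {l = lab} B (UnionExcept-least D M⊇ w∈P) a∈ b∈ (w~ a∈) (w~ b∈)
      where
        w~ : ∀ {x} → x ∈ _ → Compatible lab w x
        w~ x∈ = compatible-with-part {j} w∈P (biclique-⊆ (∪⁅⁆-⊆ (UnionExcept-least D M⊇) x∈) B)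

    biuniversal-∈-maximal : ∀ {v j M} → Biuniversal G D lab v → MaximalBiclique G M →
      ContainsAllBut D j M → Nonempty (UnionExcept G D j) → v ∈ M
    biuniversal-∈-maximal {v} (_ , v~) maxM@(B , _) M⊇ P≠∅ =
      maximal-absorbs maxM (sideLabelling⇒biclique {l = lab}
        (sideLabelling-insert {l = lab} (containsAllBut-sideLabelling B M⊇ P≠∅) v~M))
      where
        v~M : ∀ b → b ∈ _ → Compatible lab v b
        v~M b b∈M with b ≟ v
        ... | yes refl = compatible-refl {lab}
        ... | no  b≢v  = bicompatible⇒compatible (v~ b (containsAllBut-inBiexpansion D B M⊇ b∈M) b≢v)

  condI-of-helly : ∀ {p q} → 1 ≤ p → 1 ≤ q → BicliqueHelly G p q → CondI G p q
  condI-of-helly {q = q} 1≤p 1≤q helly D (_ , _ , ∣D∣≡q , U-biclique) X Y bp lab labelling =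
    ⋂ F , q≤∣core∣ , core-biuniversal
    where
      Host : Sub → Set
      Host M = MaximalBiclique G M × ∃ λ j → ContainsAllBut D j M

      root : ∃ Host
      root with M , maxM , M⊇ ← maximal-containing {D = D} {j = 0F} U-biclique (λ i _ → ∈-Union⁺ D i) =
        M , maxM , 0F , M⊇

      host-from : ∀ {w} → Dec (InBiexpansion G D w) → ∃ λ M → Host M × (InBiexpansion G D w → w ∈ M)
      host-from {w} (yes (j , B)) with M , P∪w⊆M , maxM ← extend-maximal B =
        M , (maxM , j , λ i i≢j → ⊆-trans (∈-UnionExcept⁺ D i≢j) (⊆-trans (p⊆p∪q _) P∪w⊆M)) ,
        λ _ → P∪w⊆M (∈-∪⁅⁆ w)
      host-from (no ¬inside) = proj₁ root , proj₂ root , λ inside → contradiction inside ¬inside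

      host : ∀ w → ∃ λ M → Host M × (InBiexpansion G D w → w ∈ M)
      host w = host-from (any? λ j → biclique? (UnionExcept G D j ∪ ⁅ w ⁆))

      F : List Sub
      F = proj₁ root ∷ tabulate (proj₁ ∘ host)

      hosts : All Host F
      hosts = proj₂ root ∷ tabulate⁺ (proj₁ ∘ proj₂ ∘ host)

      q≤∣core∣ : q ≤ ∣ ⋂ F ∣
      q≤∣core∣ = helly F (λ ()) (All.map proj₁ hosts)
        (intersecting-of-containsAllBut D (λ i → ≤-reflexive (sym (∣D∣≡q i))) (All.map proj₂ hosts))

      core-biuniversal : ∀ v → v ∈ ⋂ F → Biuniversal G D lab v
      core-biuniversal v v∈core =
        root-inBiexpansion root (∈-⋂⁻ {L = F} v∈core (here refl)) ,
        λ w inside w≢v → compatible⇒bicompatible (≢-sym w≢v)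
          (host-compatible (host w) (∈-⋂⁻ {L = F} v∈core (there (∈-tabulate⁺ w))) inside)
        where
          root-inBiexpansion : (R : ∃ Host) → v ∈ proj₁ R → InBiexpansion G D v
          root-inBiexpansion (_ , (B , _) , _ , R⊇) = containsAllBut-inBiexpansion D B R⊇

          host-compatible : ∀ {w} (H : ∃ λ M → Host M × (InBiexpansion G D w → w ∈ M)) →
            v ∈ proj₁ H → InBiexpansion G D w → Compatible lab v w
          host-compatible {w} (_ , ((B , _) , j , M⊇) , w∈M) v∈M inside =
            containsAllBut-sideLabelling D bp labelling B M⊇ (part-nonempty D 1≤q ∣D∣≡q 1≤p j)
              v w v∈M (w∈M inside)

  condII-of-helly : ∀ {p q} → 1 ≤ q → BicliqueHelly G p q → CondII G p q
  condII-of-helly {q = q} 1≤q helly refl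
    (B₁ , B₂ , B₃ , _ , _ , _ , ∣B₁∣≡q , ∣B₂∣≡q , ∣B₃∣≡q , B₁₂ , B₂₃ , B₃₁ , ¬B₁₂₃) =
    ¬B₁₂₃ (biclique-via-apex x meet)
    where
      B : Fin 3 → Sub
      B 0F = B₁
      B 1F = B₂
      B 2F = B₃

      q≤∣B∣ : ∀ i → q ≤ ∣ B i ∣
      q≤∣B∣ 0F = ≤-reflexive (sym ∣B₁∣≡q)
      q≤∣B∣ 1F = ≤-reflexive (sym ∣B₂∣≡q)
      q≤∣B∣ 2F = ≤-reflexive (sym ∣B₃∣≡q)

      host : ∀ l → ∃ λ M → MaximalBiclique G M × ContainsAllBut B l M
      host 0F = maximal-containing B₂₃
        λ { 0F 0≢0 → contradiction refl 0≢0 ; 1F _ → p⊆p∪q B₃ ; 2F _ → q⊆p∪q B₂ B₃ }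
      host 1F = maximal-containing B₃₁
        λ { 0F _ → q⊆p∪q B₃ B₁ ; 1F 1≢1 → contradiction refl 1≢1 ; 2F _ → p⊆p∪q B₁ }
      host 2F = maximal-containing B₁₂
        λ { 0F _ → p⊆p∪q B₂ ; 1F _ → q⊆p∪q B₁ B₂ ; 2F 2≢2 → contradiction refl 2≢2 }

      F : List Sub
      F = tabulate (proj₁ ∘ host)

      q≤∣core∣ : q ≤ ∣ ⋂ F ∣
      q≤∣core∣ = helly F (λ ()) (tabulate⁺ (proj₁ ∘ proj₂ ∘ host))
        (intersecting-of-containsAllBut B q≤∣B∣ (tabulate⁺ λ l → l , proj₂ (proj₂ (host l))))

      x = proj₁ (nonempty-of-size 1≤q q≤∣core∣)
      x∈core = proj₂ (nonempty-of-size 1≤q q≤∣core∣)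

      index-of : ∀ {a} → a ∈ B₁ ∪ B₂ ∪ B₃ → ∃ λ i → a ∈ B i
      index-of a∈ with x∈p∪q⁻ B₁ _ a∈
      ... | inj₁ a∈B₁ = 0F , a∈B₁
      ... | inj₂ a∈B₂₃ with x∈p∪q⁻ B₂ B₃ a∈B₂₃
      ...   | inj₁ a∈B₂ = 1F , a∈B₂
      ...   | inj₂ a∈B₃ = 2F , a∈B₃

      meet : ∀ a b → a ∈ B₁ ∪ B₂ ∪ B₃ → b ∈ B₁ ∪ B₂ ∪ B₃ →
        ∃ λ M → Biclique G M × x ∈ M × a ∈ M × b ∈ M
      meet a b a∈ b∈ = through (index-of a∈) (index-of b∈)
        where
          through : ∃ (λ i → a ∈ B i) → ∃ (λ j → b ∈ B j) →
            ∃ λ M → Biclique G M × x ∈ M × a ∈ M × b ∈ M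
          through (i , a∈Bᵢ) (j , b∈Bⱼ) with l , i≢l ∷ j≢l ∷ [] ← fresh (i ∷ j ∷ []) (s≤s (s≤s z≤n)) =
            let M , maxM , M⊇ = host l in
            M , proj₁ maxM , ∈-⋂-tabulate⁻ {f = proj₁ ∘ host} x∈core l , M⊇ i i≢l a∈Bᵢ , M⊇ j j≢l b∈Bⱼ

  -- The label of v is read off an anchor a ∈ Union S, chosen in a part P j with P j ∪ {v} a
  -- biclique whenever such a part exists; any two such parts share a member of S since p ≥ 2,
  -- so bicompatibility spreads from the anchor to every admissible part.
  biexpansionLabeling-exists : ∀ {p q X Y} → 2 ≤ p → 1 ≤ q → (S : Fin (suc p) → Sub) →
    (∀ i → ∣ S i ∣ ≡ q) → IsBipartition G (Union G S) X Y → ∃ (IsBiexpansionLabeling G S X Y)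
  biexpansionLabeling-exists {X = X} {Y} 2≤p 1≤q S ∣S∣≡q bp@(X∪Y≡U , _) =
    lab , lab-X , lab-Y , lab-bicompatible
    where
      U = Union G S
      P = UnionExcept G S

      inX : V → Bool
      inX v = does (v ∈? X)

      anchor : ∀ v → ∃ λ a → a ∈ U ×
        (InBiexpansion G S v → ∃ λ j → a ∈ P j × Biclique G (P j ∪ ⁅ v ⁆))
      anchor v with any? (λ j → biclique? (P j ∪ ⁅ v ⁆))
      ... | yes (j , B) = let a , a∈P = part-nonempty S 1≤q ∣S∣≡q (<⇒≤ 2≤p) j in
        a , UnionExcept⊆Union S {j} a∈P , λ _ → j , a∈P , B
      ... | no ¬inside = let a , a∈S₀ = member-nonempty S 1≤q ∣S∣≡q 0F in
        a , ∈-Union⁺ S 0F a∈S₀ , λ inside → contradiction inside ¬inside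

      lab : V → Bool
      lab v = Adj G v (proj₁ (anchor v)) xor inX (proj₁ (anchor v))

      lab-U : ∀ {v} → v ∈ U → lab v ≡ inX v
      lab-U {v} v∈U = let a , a∈U , _ = anchor v in begin
        Adj G v a xor inX a           ≡⟨ cong (_xor inX a) (indicator-sideLabelling bp v a v∈U a∈U) ⟩
        (inX v xor inX a) xor inX a   ≡⟨ xor-cancelʳ (inX v) (inX a) ⟩
        inX v                         ∎

      lab-X : ∀ v → v ∈ X → lab v ≡ true
      lab-X v v∈X = trans (lab-U (subst (v ∈_) X∪Y≡U (x∈p∪q⁺ (inj₁ v∈X)))) (dec-true (v ∈? X) v∈X)

      lab-Y : ∀ v → v ∈ Y → lab v ≡ false
      lab-Y v v∈Y = trans (lab-U (subst (v ∈_) X∪Y≡U (x∈p∪q⁺ (inj₂ v∈Y))))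
                          (dec-false (v ∈? X) λ v∈X → proj₁ (proj₂ bp) v v∈X v∈Y)

      lab-sides : SideLabelling U lab
      lab-sides = bipartition-sideLabelling bp lab-X lab-Y

      anchor-compatible : ∀ v → Compatible lab v (proj₁ (anchor v))
      anchor-compatible v = let a , a∈U , _ = anchor v in sym (begin
        lab v xor lab a                   ≡⟨ cong (lab v xor_) (lab-U a∈U) ⟩
        (Adj G v a xor inX a) xor inX a   ≡⟨ xor-cancelʳ (Adj G v a) (inX a) ⟩
        Adj G v a                         ∎)

      lab-bicompatible : ∀ v → InBiexpansion G S v → v ∉ U → ∀ j → Biclique G (P j ∪ ⁅ v ⁆) →
        ∀ w → w ∈ P j → Bicompatible G lab v w
      lab-bicompatible v inside v∉U j Bⱼ w w∈Pⱼ
        with k , a∈Pₖ , Bₖ ← proj₂ (proj₂ (anchor v)) inside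
        with l , j≢l ∷ k≢l ∷ [] ← fresh (j ∷ k ∷ []) 2≤p =
        compatible⇒bicompatible (λ { refl → v∉U (UnionExcept⊆Union S {j} w∈Pⱼ) }) v~w
        where
          c = proj₁ (member-nonempty S 1≤q ∣S∣≡q l)
          c∈Sₗ = proj₂ (member-nonempty S 1≤q ∣S∣≡q l)
          c∈Pⱼ = ∈-UnionExcept⁺ S (≢-sym j≢l) c∈Sₗ
          c∈Pₖ = ∈-UnionExcept⁺ S (≢-sym k≢l) c∈Sₗ
          in-U : ∀ {i x} → x ∈ P i → x ∈ U
          in-U {i} = UnionExcept⊆Union S {i}
          v~c : Compatible lab v c
          v~c = compatible-through {l = lab} Bₖ (p⊆p∪q _ a∈Pₖ) (∈-∪⁅⁆ v) (p⊆p∪q _ c∈Pₖ)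
                  (compatible-sym {lab} (anchor-compatible v))
                  (lab-sides _ c (in-U {k} a∈Pₖ) (in-U {k} c∈Pₖ))
          v~w : Compatible lab v w
          v~w = compatible-through {l = lab} Bⱼ (p⊆p∪q _ c∈Pⱼ) (∈-∪⁅⁆ v) (p⊆p∪q _ w∈Pⱼ)
                  (compatible-sym {lab} v~c) (lab-sides c w (in-U {j} c∈Pⱼ) (in-U {j} w∈Pⱼ))

  union-biclique : ∀ {p q} → 2 ≤ p → 1 ≤ q → CondII G p q → (S : Fin (suc p) → Sub) →
    (∀ i → Biclique G (S i)) → (∀ i → ∣ S i ∣ ≡ q) →
    (∀ l → ∃ λ M → Biclique G M × ContainsAllBut S l M) → Biclique G (Union G S)
  union-biclique {1} (s≤s ()) _ _ _ _ _ _
  union-biclique {2} _ _ condII S S-biclique ∣S∣≡q hosts with biclique? (Union G S)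
  ... | yes U-biclique = U-biclique
  ... | no ¬U-biclique = ⊥-elim (condII refl
        ( S 0F , S 1F , S 2F , S-biclique 0F , S-biclique 1F , S-biclique 2F
        , ∣S∣≡q 0F , ∣S∣≡q 1F , ∣S∣≡q 2F
        , pair 0F 1F 2F (λ ()) (λ ()) , pair 1F 2F 0F (λ ()) (λ ()) , pair 2F 0F 1F (λ ()) (λ ())
        , λ B → ¬U-biclique (biclique-⊆ U⊆S₀₁₂ B)))
    where
      pair : ∀ i j l → i ≢ l → j ≢ l → Biclique G (S i ∪ S j)
      pair i j l i≢l j≢l = let M , B , M⊇ = hosts l in biclique-⊆ (∪-least (M⊇ i i≢l) (M⊇ j j≢l)) B
      U⊆S₀₁₂ : Union G S ⊆ S 0F ∪ S 1F ∪ S 2F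
      U⊆S₀₁₂ x∈ with ∈-Union⁻ S x∈
      ... | 0F , x∈S₀ = x∈p∪q⁺ (inj₁ x∈S₀)
      ... | 1F , x∈S₁ = x∈p∪q⁺ (inj₂ (x∈p∪q⁺ (inj₁ x∈S₁)))
      ... | 2F , x∈S₂ = x∈p∪q⁺ (inj₂ (x∈p∪q⁺ (inj₂ x∈S₂)))
  union-biclique {suc (suc (suc _))} _ 1≤q _ S _ ∣S∣≡q hosts =
    biclique-via-apex x λ a b a∈ b∈ → meet (∈-Union⁻ S a∈) (∈-Union⁻ S b∈)
    where
      x = proj₁ (member-nonempty S 1≤q ∣S∣≡q 0F)
      x∈S₀ = proj₂ (member-nonempty S 1≤q ∣S∣≡q 0F)
      meet : ∀ {a b} → ∃ (λ i → a ∈ S i) → ∃ (λ j → b ∈ S j) →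
        ∃ λ M → Biclique G M × x ∈ M × a ∈ M × b ∈ M
      meet (i , a∈Sᵢ) (j , b∈Sⱼ)
        with l , 0≢l ∷ i≢l ∷ j≢l ∷ [] ← fresh (0F ∷ i ∷ j ∷ []) (s≤s (s≤s (s≤s z≤n))) =
        let M , B , M⊇ = hosts l in M , B , M⊇ 0F 0≢l x∈S₀ , M⊇ i i≢l a∈Sᵢ , M⊇ j j≢l b∈Sⱼ

  module _ {p q} (2≤p : 2 ≤ p) (1≤q : 1 ≤ q) (condI : CondI G p q) (condII : CondII G p q) where

    core-bound-of-distinct : ∀ {k} (f : Fin k → Sub) → (∀ a → MaximalBiclique G (f a)) →
      (S : Fin (suc p) → Sub) → (∀ i → ∣ S i ∣ ≡ q) → (∀ i i′ → S i ≡ S i′ → i ≡ i′) →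
      (∀ a → ∃ λ j → ContainsAllBut S j (f a)) → (∀ l → ∃ λ a → ContainsAllBut S l (f a)) →
      q ≤ ∣ ⋂ (tabulate f) ∣
    core-bound-of-distinct f maximal S ∣S∣≡q distinct covers realised =
      via-bipartition (proj₂ (proj₂ U-biclique))
      where
        hosts : ∀ l → ∃ λ M → Biclique G M × ContainsAllBut S l M
        hosts l = let a , f⊇ = realised l in f a , proj₁ (maximal a) , f⊇

        S-biclique : ∀ i → Biclique G (S i)
        S-biclique i with l , i≢l ∷ [] ← fresh (i ∷ []) (<⇒≤ 2≤p) =
          let M , B , M⊇ = hosts l in biclique-⊆ (M⊇ i i≢l) B

        U-biclique : Biclique G (Union G S)
        U-biclique = union-biclique 2≤p 1≤q condII S S-biclique ∣S∣≡q hosts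

        via-bipartition : ∀ {X Y} → IsBipartition G (Union G S) X Y → q ≤ ∣ ⋂ (tabulate f) ∣
        via-bipartition {X} {Y} bp
          with lab , labelling ← biexpansionLabeling-exists 2≤p 1≤q S ∣S∣≡q bp
          with T , q≤∣T∣ , biuniversal ←
                 condI S (distinct , S-biclique , ∣S∣≡q , U-biclique) X Y bp lab labelling =
          ≤-trans q≤∣T∣ (p⊆q⇒∣p∣≤∣q∣ λ {v} v∈T → ∈-⋂-tabulate⁺ f λ a →
            let j , f⊇ = covers a in
            biuniversal-∈-maximal S bp labelling (biuniversal v v∈T) (maximal a) f⊇
              (part-nonempty S 1≤q ∣S∣≡q (<⇒≤ 2≤p) j))

    core-bound-of-covering : ∀ {k} (f : Fin k → Sub) → (∀ a → MaximalBiclique G (f a)) →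
      (S : Fin (suc p) → Sub) → (∀ i → ∣ S i ∣ ≡ q) →
      (∀ a → ∃ λ j → ContainsAllBut S j (f a)) → (∀ l → ∃ λ a → ContainsAllBut S l (f a)) →
      q ≤ ∣ ⋂ (tabulate f) ∣
    core-bound-of-covering f maximal S ∣S∣≡q covers realised
      with any? (λ i → any? λ i′ → ¬? (i ≟ i′) ×-dec ≡-dec _≟ᵇ_ (S i) (S i′))
    ... | yes (i , i′ , i≢i′ , Sᵢ≡Sᵢ′) =
      subst (_≤ _) (∣S∣≡q i) (p⊆q⇒∣p∣≤∣q∣ (core-⊇-duplicate covers i≢i′ Sᵢ≡Sᵢ′))
    ... | no no-duplicate = core-bound-of-distinct f maximal S ∣S∣≡q distinct covers realised
      where
        distinct : ∀ i i′ → S i ≡ S i′ → i ≡ i′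
        distinct i i′ Sᵢ≡Sᵢ′ = decidable-stable (i ≟ i′) λ i≢i′ → no-duplicate (i , i′ , i≢i′ , Sᵢ≡Sᵢ′)

    core-bound : ∀ k (f : Fin (suc k) → Sub) → (∀ a → MaximalBiclique G (f a)) →
      Intersecting (n G) p q (tabulate f) → q ≤ ∣ ⋂ (tabulate f) ∣
    core-bound k f maximal intersecting with suc k ≤? p
    ... | yes small =
      intersecting (tabulate f) (λ ()) (subst (_≤ p) (sym (length-tabulate f)) small) (λ _ M∈ → M∈)
    core-bound zero    f maximal intersecting | no 1≰p = contradiction (<⇒≤ 2≤p) 1≰p
    core-bound (suc k) f maximal intersecting | no large =
      core-bound-of-covering f maximal S (λ i → proj₂ (proj₂ (core-subset i))) covers realised
      where
        position : Fin (suc p) → Fin (suc (suc k))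
        position i = inject≤ i (≰⇒> large)

        dropping : Fin (suc p) → Fin (suc k) → Sub
        dropping i = f ∘ punchIn (position i)

        core-subset : ∀ i → ∃ λ T → T ⊆ ⋂ (tabulate (dropping i)) × ∣ T ∣ ≡ q
        core-subset i = ⊆-of-size q _ (core-bound k (dropping i) (maximal ∘ punchIn (position i))
                 (intersecting-mono (λ _ → ∈-tabulate-∘ {f = f} {punchIn (position i)}) intersecting))

        S : Fin (suc p) → Sub
        S i = proj₁ (core-subset i)

        S⊆ : ∀ i {a} → position i ≢ a → S i ⊆ f a
        S⊆ i {a} i≢a x∈ = subst (_ ∈_) (cong f (punchIn-punchOut i≢a))
          (∈-⋂-tabulate⁻ {f = dropping i} (proj₁ (proj₂ (core-subset i)) x∈) (punchOut i≢a))

        covers : ∀ a → ∃ λ j → ContainsAllBut S j (f a)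
        covers a with any? (λ i → position i ≟ a)
        ... | yes (j , j↦a) = j , λ i i≢j → S⊆ i λ i↦a →
                i≢j (inject≤-injective _ _ i j (trans i↦a (sym j↦a)))
        ... | no  unhit = 0F , λ i _ → S⊆ i λ i↦a → unhit (i , i↦a)

        realised : ∀ l → ∃ λ a → ContainsAllBut S l (f a)
        realised l = position l , λ i i≢l → S⊆ i (i≢l ∘ inject≤-injective _ _ i l)

  helly-of-conditions : ∀ {p q} → 2 ≤ p → 1 ≤ q → CondI G p q → CondII G p q → BicliqueHelly G p q
  helly-of-conditions _ _ _ _ [] []≢[] = contradiction refl []≢[]
  helly-of-conditions {p} {q} 2≤p 1≤q condI condII F@(_ ∷ F′) _ maximal intersecting =
    subst (λ F → q ≤ ∣ ⋂ F ∣) (tabulate-lookup F)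
      (core-bound 2≤p 1≤q condI condII (length F′) (lookup F) (λ a → All.lookup maximal (∈-lookup a))
        (subst (Intersecting (n G) p q) (sym (tabulate-lookup F)) intersecting))

theorem4p7 : (G : Graph) (p q : ℕ) → 2 ≤ p → 1 ≤ q →
    (BicliqueHelly G p q → CondI G p q × CondII G p q) ×
    (CondI G p q × CondII G p q → BicliqueHelly G p q)
theorem4p7 G p q 2≤p 1≤q =
  (λ helly → condI-of-helly G (<⇒≤ 2≤p) 1≤q helly , condII-of-helly G 1≤q helly) ,
  (λ (condI , condII) → helly-of-conditions G 2≤p 1≤q condI condII)
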